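{- (1) Let $f=(f_n)_{n\ge1}$ be a sequence of nonzero integers with $f_n\mid f_{n+1}$ for every $n\ge1$. Then $f$ is binomid at every level. (2) Let $\psi=(\psi(n))_{n\ge1}$ be a sequence of nonzero integers with $\psi(mn)=\psi(m)\psi(n)$ for all $m,n\ge1$, let $f$ be a sequence of positive integers, and let $c\ge0$ be an integer. If $f$ is binomid at level $c$, then $\psi\circ f=(\psi(f_n))_{n\ge1}$ is binomid at level $c$.
   Context: For a sequence $h=(h_1,h_2,\dots)$ of nonzero rational numbers and integers $0\le k\le n$, $\left[{n\atop k}\right]_h=\dfrac{h_nh_{n-1}\cdots h_{n-k+1}}{h_kh_{k-1}\cdots h_1}$ (equal to $1$ for $k=0$); $h$ is binomid if every such coefficient is an integer. For an integer $c\ge0$, the column $c$ sequence of $f$ is $C_c(N)=\left[{N+c-1\atop c}\right]_f$ for $N\ge1$. The sequence $f$ is binomid at level $c$ if $C_c$ is binomid, and binomid at every level if it is binomid at level $c$ for every $c\ge0$. -}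

module Defs where

open import Data.Nat using (ℕ; zero; suc; _+_; _∸_; _≤_)
open import Data.Integer as ℤ using (ℤ)
open import Data.Rational as ℚ using (ℚ; 0ℚ; 1ℚ; _*_; _÷_; ≢-nonZero)
open import Data.Rational.Properties using (_≟_)
open import Data.Product using (Σ; _×_; ∃)
open import Relation.Nullary using (yes; no; ¬_)
open import Relation.Binary.PropositionalEquality using (_≡_; _≢_)

-- A sequence h = (h_1, h_2, ...) is represented 0-based: s i = h_(i+1).
Seq : Set
Seq = ℕ → ℚ

prod : ℕ → (ℕ → ℚ) → ℚ
prod zero    g = 1ℚ
prod (suc k) g = prod k g * g k

-- Total division on ℚ (only ever used with nonzero denominators below,
-- since binomid sequences are required to consist of nonzero terms).
divQ : ℚ → ℚ → ℚ
divQ p q with q ≟ 0ℚ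
... | yes _  = 0ℚ
... | no q≢0 = _÷_ p q {{≢-nonZero q≢0}}

-- [n k]_h = (h_n h_(n-1) ... h_(n-k+1)) / (h_k ... h_1)
-- numerator: ∏_(j<k) h_(n-j) = ∏_(j<k) s (n ∸ suc j); denominator: ∏_(j<k) s j
gbinom : Seq → ℕ → ℕ → ℚ
gbinom s n k = divQ (prod k (λ j → s (n ∸ suc j))) (prod k s)

IsInt : ℚ → Set
IsInt q = ∃ λ (z : ℤ) → q ≡ ℚ._/_ z 1

Binomid : Seq → Set
Binomid s = (∀ i → s i ≢ 0ℚ) × (∀ n k → k ≤ n → IsInt (gbinom s n k))

-- Column c sequence: C_c(N) = [N+c-1 c]_f for N ≥ 1; 0-based: i = N-1.
Col : Seq → ℕ → Seq
Col f c i = gbinom f (i + c) c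

BinomidAtLevel : Seq → ℕ → Set
BinomidAtLevel f c = Binomid (Col f c)

BinomidAtEveryLevel : Seq → Set
BinomidAtEveryLevel f = ∀ c → BinomidAtLevel f c

-- The column sequence is C_c(N) = F(N) / D with F(N) = f_N f_(N+1) ⋯ f_(N+c-1)
-- and D = f_1 ⋯ f_c.  The constant D cancels in every generalised binomial
-- coefficient, so f is binomid at level c exactly when F is binomid, and for
-- integer-valued F this means F(1) ⋯ F(k) ∣ F(n) ⋯ F(n-k+1).
-- (1) If f is a divisibility chain then so is F, and a divisibility chain is
-- binomid: F(k+1-j) ∣ F(n+1-j) for every j.
-- (2) A multiplicative ψ preserves divisibility between positive integers and
-- commutes with products of positive integers, so it carries the divisibilities
-- for F = F_f over to those for F_(ψ∘f).
module Submission where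

open import Defs
open import Data.Nat using (ℕ; suc; _*_; _≤_)
open import Data.Integer as ℤ using (ℤ; +_)
open import Data.Integer.Divisibility using (_∣_)
open import Data.Rational using (ℚ; _/_)
open import Data.Product using (_×_)
open import Relation.Binary.PropositionalEquality using (_≡_; _≢_)

open import Data.Nat as ℕ using (zero; _∸_; _+_; _≤′_; ≤′-refl; ≤′-step)
import Data.Nat.Properties as ℕP
import Data.Nat.Divisibility as ℕD
import Data.Integer.Properties as ℤP
import Data.Integer.Divisibility as ℤ∣
import Data.Integer.Divisibility.Signed as ℤD
open import Data.Rational as ℚ using (mkℚ; 0ℚ; 1ℚ; 1/_; ↥_; ≢-nonZero)
import Data.Rational.Properties as ℚP
open import Data.Rational.Properties using (_≟_)
import Data.Nat.Coprimality as Coprimality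
open import Data.Product using (_,_)
open import Data.Sum using (inj₁; inj₂)
open import Data.Empty using (⊥-elim)
open import Function using (_∘_; _⇔_; mk⇔; Equivalence)
open import Relation.Binary.Core using (_Preserves_⟶_)
open import Relation.Nullary using (yes; no)
open import Relation.Binary.PropositionalEquality
  using (refl; sym; trans; cong; cong₂; subst; subst₂; module ≡-Reasoning)
open ≡-Reasoning

divQ-inverseʳ : ∀ p {q} → q ≢ 0ℚ → divQ p q ℚ.* q ≡ p
divQ-inverseʳ p {q} q≢0 with q ≟ 0ℚ
... | yes q≡0 = ⊥-elim (q≢0 q≡0)
... | no q≢0′ = begin
  p ℚ.* 1/ q ℚ.* q   ≡⟨ ℚP.*-assoc p (1/ q) q ⟩
  p ℚ.* (1/ q ℚ.* q) ≡⟨ cong (p ℚ.*_) (ℚP.*-inverseˡ q) ⟩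
  p ℚ.* 1ℚ           ≡⟨ ℚP.*-identityʳ p ⟩
  p                  ∎
  where instance _ = ≢-nonZero q≢0′

divQ-unique : ∀ {p q r} → q ≢ 0ℚ → r ℚ.* q ≡ p → divQ p q ≡ r
divQ-unique {p} {q} {r} q≢0 r*q≡p with q ≟ 0ℚ
... | yes q≡0 = ⊥-elim (q≢0 q≡0)
... | no q≢0′ = begin
  p ℚ.* 1/ q         ≡⟨ cong (ℚ._* 1/ q) (sym r*q≡p) ⟩
  r ℚ.* q ℚ.* 1/ q   ≡⟨ ℚP.*-assoc r q (1/ q) ⟩
  r ℚ.* (q ℚ.* 1/ q) ≡⟨ cong (r ℚ.*_) (ℚP.*-inverseʳ q) ⟩
  r ℚ.* 1ℚ           ≡⟨ ℚP.*-identityʳ r ⟩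
  r                  ∎
  where instance _ = ≢-nonZero q≢0′

*-cancelʳ-≢0 : ∀ {a b c} → c ≢ 0ℚ → a ℚ.* c ≡ b ℚ.* c → a ≡ b
*-cancelʳ-≢0 c≢0 eq = trans (sym (divQ-unique c≢0 refl)) (divQ-unique c≢0 (sym eq))

*-≢0 : ∀ {a b} → a ≢ 0ℚ → b ≢ 0ℚ → a ℚ.* b ≢ 0ℚ
*-≢0 {a} {b} a≢0 b≢0 a*b≡0 = b≢0 (*-cancelʳ-≢0 a≢0 (begin
  b ℚ.* a  ≡⟨ ℚP.*-comm b a ⟩
  a ℚ.* b  ≡⟨ a*b≡0 ⟩
  0ℚ       ≡⟨ ℚP.*-zeroˡ a ⟨
  0ℚ ℚ.* a ∎))

divQ-≢0 : ∀ {p q} → p ≢ 0ℚ → q ≢ 0ℚ → divQ p q ≢ 0ℚ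
divQ-≢0 {p} {q} p≢0 q≢0 p/q≡0 = p≢0 (begin
  p               ≡⟨ divQ-inverseʳ p q≢0 ⟨
  divQ p q ℚ.* q  ≡⟨ cong (ℚ._* q) p/q≡0 ⟩
  0ℚ ℚ.* q        ≡⟨ ℚP.*-zeroˡ q ⟩
  0ℚ              ∎)

divQ-≢0⁻¹ : ∀ {p q} → q ≢ 0ℚ → divQ p q ≢ 0ℚ → p ≢ 0ℚ
divQ-≢0⁻¹ {q = q} q≢0 p/q≢0 refl = p/q≢0 (divQ-unique q≢0 (ℚP.*-zeroˡ q))

prod-cong : ∀ k {g h} → (∀ j → g j ≡ h j) → prod k g ≡ prod k h
prod-cong zero    g≗h = refl
prod-cong (suc k) g≗h = cong₂ ℚ._*_ (prod-cong k g≗h) (g≗h k)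

prod-distrib-* : ∀ k g h → prod k (λ j → g j ℚ.* h j) ≡ prod k g ℚ.* prod k h
prod-distrib-* zero    g h = sym (ℚP.*-identityˡ 1ℚ)
prod-distrib-* (suc k) g h = begin
  prod k (λ j → g j ℚ.* h j) ℚ.* (g k ℚ.* h k) ≡⟨ cong (ℚ._* (g k ℚ.* h k)) (prod-distrib-* k g h) ⟩
  (G ℚ.* H) ℚ.* (g k ℚ.* h k)                 ≡⟨ ℚP.*-assoc G H (g k ℚ.* h k) ⟩
  G ℚ.* (H ℚ.* (g k ℚ.* h k))                 ≡⟨ cong (G ℚ.*_) (ℚP.*-assoc H (g k) (h k)) ⟨
  G ℚ.* ((H ℚ.* g k) ℚ.* h k)                 ≡⟨ cong (λ x → G ℚ.* (x ℚ.* h k)) (ℚP.*-comm H (g k)) ⟩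
  G ℚ.* ((g k ℚ.* H) ℚ.* h k)                 ≡⟨ cong (G ℚ.*_) (ℚP.*-assoc (g k) H (h k)) ⟩
  G ℚ.* (g k ℚ.* (H ℚ.* h k))                 ≡⟨ ℚP.*-assoc G (g k) (H ℚ.* h k) ⟨
  (G ℚ.* g k) ℚ.* (H ℚ.* h k)                 ∎
  where
  G H : ℚ
  G = prod k g
  H = prod k h

prod-≢0 : ∀ k {g} → (∀ j → g j ≢ 0ℚ) → prod k g ≢ 0ℚ
prod-≢0 zero    g≢0 ()
prod-≢0 (suc k) g≢0 = *-≢0 (prod-≢0 k g≢0) (g≢0 k)

prod-divQ : ∀ k g {d} → d ≢ 0ℚ →
            prod k (λ j → divQ (g j) d) ℚ.* prod k (λ _ → d) ≡ prod k g
prod-divQ k g d≢0 = trans (sym (prod-distrib-* k _ _)) (prod-cong k (λ j → divQ-inverseʳ (g j) d≢0))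

gbinom-cong : ∀ {s t} → (∀ i → s i ≡ t i) → ∀ n k → gbinom s n k ≡ gbinom t n k
gbinom-cong s≗t n k = cong₂ divQ (prod-cong k (λ j → s≗t (n ∸ suc j))) (prod-cong k s≗t)

gbinom-inverseʳ : ∀ {s} → (∀ i → s i ≢ 0ℚ) → ∀ n k →
                  gbinom s n k ℚ.* prod k s ≡ prod k (λ j → s (n ∸ suc j))
gbinom-inverseʳ s≢0 n k = divQ-inverseʳ _ (prod-≢0 k s≢0)

gbinom-divQ : ∀ {s d} → d ≢ 0ℚ → (∀ i → s i ≢ 0ℚ) → ∀ n k →
              gbinom (λ i → divQ (s i) d) n k ≡ gbinom s n k
gbinom-divQ {s} {d} d≢0 s≢0 n k =
  divQ-unique (prod-≢0 k (λ i → divQ-≢0 (s≢0 i) d≢0)) (*-cancelʳ-≢0 (prod-≢0 k (λ _ → d≢0)) (begin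
    X ℚ.* prod k s′ ℚ.* Dᵏ                   ≡⟨ ℚP.*-assoc X (prod k s′) Dᵏ ⟩
    X ℚ.* (prod k s′ ℚ.* Dᵏ)                 ≡⟨ cong (X ℚ.*_) (prod-divQ k s d≢0) ⟩
    X ℚ.* prod k s                           ≡⟨ gbinom-inverseʳ s≢0 n k ⟩
    prod k (λ j → s (n ∸ suc j))             ≡⟨ prod-divQ k (λ j → s (n ∸ suc j)) d≢0 ⟨
    prod k (λ j → s′ (n ∸ suc j)) ℚ.* Dᵏ     ∎))
  where
  s′ : Seq
  s′ i = divQ (s i) d
  X Dᵏ : ℚ
  X  = gbinom s n k
  Dᵏ = prod k (λ _ → d)

Binomid-cong : ∀ {s t} → (∀ i → s i ≡ t i) → Binomid s → Binomid t
Binomid-cong s≗t (s≢0 , int) =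
  (λ i → subst (_≢ 0ℚ) (s≗t i) (s≢0 i)) ,
  (λ n k k≤n → subst IsInt (gbinom-cong s≗t n k) (int n k k≤n))

Binomid-divQ : ∀ {s d} → d ≢ 0ℚ → Binomid (λ i → divQ (s i) d) ⇔ Binomid s
Binomid-divQ {s} {d} d≢0 = mk⇔
  (λ (s′≢0 , int) → let s≢0 = λ i → divQ-≢0⁻¹ d≢0 (s′≢0 i) in
    s≢0 , λ n k k≤n → subst IsInt (gbinom-divQ d≢0 s≢0 n k) (int n k k≤n))
  (λ (s≢0 , int) →
    (λ i → divQ-≢0 (s≢0 i) d≢0) ,
    λ n k k≤n → subst IsInt (sym (gbinom-divQ d≢0 s≢0 n k)) (int n k k≤n))

colNumerator : Seq → ℕ → Seq
colNumerator s c i = prod c (λ j → s (i + c ∸ suc j))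

-- Col s c i unfolds to divQ (colNumerator s c i) (prod c s).
BinomidAtLevel⇔colNumerator : ∀ {s} c → (∀ i → s i ≢ 0ℚ) →
                              BinomidAtLevel s c ⇔ Binomid (colNumerator s c)
BinomidAtLevel⇔colNumerator c s≢0 = Binomid-divQ (prod-≢0 c s≢0)

/1≡mkℚ : ∀ z → z / 1 ≡ mkℚ z 0 (Coprimality.sym (Coprimality.1-coprimeTo ℤ.∣ z ∣))
/1≡mkℚ (+ n)        = ℚP.normalize-coprime (Coprimality.sym (Coprimality.1-coprimeTo n))
/1≡mkℚ ℤ.-[1+ n ]   = cong ℚ.-_ (ℚP.normalize-coprime (Coprimality.sym (Coprimality.1-coprimeTo (suc n))))

/1-injective : ∀ {a b} → a / 1 ≡ b / 1 → a ≡ b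
/1-injective {a} {b} eq = begin
  a          ≡⟨ cong ↥_ (/1≡mkℚ a) ⟨
  ↥ (a / 1)  ≡⟨ cong ↥_ eq ⟩
  ↥ (b / 1)  ≡⟨ cong ↥_ (/1≡mkℚ b) ⟩
  b          ∎

/1-≢0 : ∀ {z} → z ≢ + 0 → z / 1 ≢ 0ℚ
/1-≢0 z≢0 eq = z≢0 (/1-injective eq)

-- Once both factors are in the canonical form mkℚ _ 0 _, the product normalises to (a ℤ.* b) / 1.
/1-homo-* : ∀ a b → (a / 1) ℚ.* (b / 1) ≡ (a ℤ.* b) / 1
/1-homo-* a b = cong₂ ℚ._*_ (/1≡mkℚ a) (/1≡mkℚ b)

IsInt-divQ⇔∣ : ∀ {a} b → a ≢ + 0 → IsInt (divQ (b / 1) (a / 1)) ⇔ a ∣ b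
IsInt-divQ⇔∣ {a} b a≢0 = mk⇔
  (λ (w , b/a≡w) → ℤD.∣⇒∣ᵤ {a} {b} (ℤD.divides w (/1-injective (begin
    b / 1                            ≡⟨ divQ-inverseʳ (b / 1) (/1-≢0 a≢0) ⟨
    divQ (b / 1) (a / 1) ℚ.* (a / 1) ≡⟨ cong (ℚ._* (a / 1)) b/a≡w ⟩
    (w / 1) ℚ.* (a / 1)              ≡⟨ /1-homo-* w a ⟩
    (w ℤ.* a) / 1                    ∎))))
  (λ a∣b → let ℤD.divides w b≡w*a = ℤD.∣ᵤ⇒∣ {a} {b} a∣b in
    w , divQ-unique (/1-≢0 a≢0) (trans (/1-homo-* w a) (cong (_/ 1) (sym b≡w*a))))

prodℤ : ℕ → (ℕ → ℤ) → ℤ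
prodℤ zero    g = + 1
prodℤ (suc k) g = prodℤ k g ℤ.* g k

prod-/1 : ∀ k g → prod k (λ j → g j / 1) ≡ prodℤ k g / 1
prod-/1 zero    g = refl
prod-/1 (suc k) g = trans (cong (ℚ._* (g k / 1)) (prod-/1 k g)) (/1-homo-* (prodℤ k g) (g k))

prodℤ-cong : ∀ k {g h} → (∀ j → g j ≡ h j) → prodℤ k g ≡ prodℤ k h
prodℤ-cong zero    g≗h = refl
prodℤ-cong (suc k) g≗h = cong₂ ℤ._*_ (prodℤ-cong k g≗h) (g≗h k)

prodℤ-≢0 : ∀ k {g} → (∀ j → g j ≢ + 0) → prodℤ k g ≢ + 0
prodℤ-≢0 zero    g≢0 ()
prodℤ-≢0 (suc k) g≢0 eq with ℤP.i*j≡0⇒i≡0∨j≡0 (prodℤ k _) eq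
... | inj₁ G≡0 = prodℤ-≢0 k g≢0 G≡0
... | inj₂ g≡0 = g≢0 k g≡0

prodℤ-shift : ∀ k g → prodℤ (suc k) g ≡ g 0 ℤ.* prodℤ k (g ∘ suc)
prodℤ-shift zero    g = ℤP.*-comm (+ 1) (g 0)
prodℤ-shift (suc k) g = trans (cong (ℤ._* g (suc k)) (prodℤ-shift k g))
                              (ℤP.*-assoc (g 0) (prodℤ k (g ∘ suc)) (g (suc k)))

prodℤ-reverse : ∀ k g → prodℤ k g ≡ prodℤ k (λ j → g (k ∸ suc j))
prodℤ-reverse zero    g = refl
prodℤ-reverse (suc k) g = begin
  prodℤ k g ℤ.* g k                         ≡⟨ ℤP.*-comm (prodℤ k g) (g k) ⟩
  g k ℤ.* prodℤ k g                         ≡⟨ cong (g k ℤ.*_) (prodℤ-reverse k g) ⟩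
  g k ℤ.* prodℤ k (λ j → g (k ∸ suc j))     ≡⟨ prodℤ-shift k (λ j → g (suc k ∸ suc j)) ⟨
  prodℤ (suc k) (λ j → g (suc k ∸ suc j))   ∎

prodℤ-∣ : ∀ k {g h} → (∀ j → g j ∣ h j) → prodℤ k g ∣ prodℤ k h
prodℤ-∣ zero    g∣h = ℕD.∣-refl
prodℤ-∣ (suc k) {g} {h} g∣h = ℕD.∣-trans
  (ℤ∣.*-monoˡ-∣ (g k) {prodℤ k g} {prodℤ k h} (prodℤ-∣ k g∣h))
  (ℤ∣.*-monoʳ-∣ (prodℤ k h) {g k} {h k} (g∣h k))

BinomiallyDivisible : (ℕ → ℤ) → Set
BinomiallyDivisible h = ∀ n k → k ≤ n → prodℤ k h ∣ prodℤ k (λ j → h (n ∸ suc j))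

BinomiallyDivisible-cong : ∀ {g h} → (∀ i → g i ≡ h i) →
                           BinomiallyDivisible g → BinomiallyDivisible h
BinomiallyDivisible-cong g≗h div n k k≤n =
  subst₂ _∣_ (prodℤ-cong k g≗h) (prodℤ-cong k (λ j → g≗h (n ∸ suc j))) (div n k k≤n)

Binomid-/1⇔BinomiallyDivisible : ∀ {h} → (∀ i → h i ≢ + 0) →
                                  Binomid (λ i → h i / 1) ⇔ BinomiallyDivisible h
Binomid-/1⇔BinomiallyDivisible {h} h≢0 = mk⇔
  (λ (_ , int) n k k≤n → Equivalence.to (IsInt⇔∣ n k) (int n k k≤n))
  (λ div → (λ i → /1-≢0 (h≢0 i)) , λ n k k≤n → Equivalence.from (IsInt⇔∣ n k) (div n k k≤n))
  where
  IsInt⇔∣ : ∀ n k → IsInt (gbinom (λ i → h i / 1) n k) ⇔ prodℤ k h ∣ prodℤ k (λ j → h (n ∸ suc j))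
  IsInt⇔∣ n k = subst (λ x → IsInt x ⇔ prodℤ k h ∣ prodℤ k (λ j → h (n ∸ suc j)))
    (cong₂ divQ (sym (prod-/1 k (λ j → h (n ∸ suc j)))) (sym (prod-/1 k h)))
    (IsInt-divQ⇔∣ (prodℤ k (λ j → h (n ∸ suc j))) (prodℤ-≢0 k h≢0))

colNumeratorℤ : (ℕ → ℤ) → ℕ → ℕ → ℤ
colNumeratorℤ h c i = prodℤ c (λ j → h (i + c ∸ suc j))

BinomidAtLevel⇔BinomiallyDivisible : ∀ {h} c → (∀ i → h i ≢ + 0) →
  BinomidAtLevel (λ i → h i / 1) c ⇔ BinomiallyDivisible (colNumeratorℤ h c)
BinomidAtLevel⇔BinomiallyDivisible {h} c h≢0 = mk⇔
  (Equivalence.to integral ∘ Binomid-cong (λ i → prod-/1 c _) ∘ Equivalence.to atLevel)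
  (Equivalence.from atLevel ∘ Binomid-cong (λ i → sym (prod-/1 c _)) ∘ Equivalence.from integral)
  where
  atLevel : BinomidAtLevel (λ i → h i / 1) c ⇔ Binomid (colNumerator (λ i → h i / 1) c)
  atLevel = BinomidAtLevel⇔colNumerator c (λ i → /1-≢0 (h≢0 i))
  integral : Binomid (λ i → colNumeratorℤ h c i / 1) ⇔ BinomiallyDivisible (colNumeratorℤ h c)
  integral = Binomid-/1⇔BinomiallyDivisible (λ i → prodℤ-≢0 c (λ j → h≢0 _))

∣-chain⇒∣-mono : ∀ {h : ℕ → ℤ} → (∀ i → h i ∣ h (suc i)) → h Preserves _≤_ ⟶ _∣_
∣-chain⇒∣-mono {h} step i≤j = go (ℕP.≤⇒≤′ i≤j)
  where
  go : ∀ {i j} → i ≤′ j → h i ∣ h j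
  go ≤′-refl        = ℕD.∣-refl
  go (≤′-step i≤′j) = ℕD.∣-trans (go i≤′j) (step _)

colNumeratorℤ-∣-mono : ∀ {h} c → h Preserves _≤_ ⟶ _∣_ →
                       colNumeratorℤ h c Preserves _≤_ ⟶ _∣_
colNumeratorℤ-∣-mono c mono i≤i′ = prodℤ-∣ c (λ j → mono (ℕP.∸-monoˡ-≤ (suc j) (ℕP.+-monoˡ-≤ c i≤i′)))

∣-mono⇒BinomiallyDivisible : ∀ {h} → h Preserves _≤_ ⟶ _∣_ → BinomiallyDivisible h
∣-mono⇒BinomiallyDivisible {h} mono n k k≤n =
  subst (_∣ prodℤ k (λ j → h (n ∸ suc j))) (sym (prodℤ-reverse k h))
    (prodℤ-∣ k (λ j → mono (ℕP.∸-monoˡ-≤ (suc j) k≤n)))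

∣-chain⇒BinomidAtEveryLevel : (f : ℕ → ℤ) → (∀ i → f i ≢ + 0) → (∀ i → f i ∣ f (suc i)) →
                              BinomidAtEveryLevel (λ i → f i / 1)
∣-chain⇒BinomidAtEveryLevel f f≢0 step c =
  Equivalence.from (BinomidAtLevel⇔BinomiallyDivisible c f≢0)
    (∣-mono⇒BinomiallyDivisible (colNumeratorℤ-∣-mono {f} c (∣-chain⇒∣-mono {f} step)))

prodℕ : ℕ → (ℕ → ℕ) → ℕ
prodℕ zero    g = 1
prodℕ (suc k) g = prodℕ k g * g k

prodℕ-positive : ∀ k {g} → (∀ j → 1 ≤ g j) → 1 ≤ prodℕ k g
prodℕ-positive zero    g≥1 = ℕP.≤-refl
prodℕ-positive (suc k) g≥1 = ℕP.*-mono-≤ (prodℕ-positive k g≥1) (g≥1 k)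

IsMultiplicative : (ℕ → ℤ) → Set
IsMultiplicative ψ = ∀ m n → 1 ≤ m → 1 ≤ n → ψ (m * n) ≡ ψ m ℤ.* ψ n

+-isMultiplicative : IsMultiplicative (λ n → + n)
+-isMultiplicative m n _ _ = ℤP.pos-* m n

multiplicative-1 : ∀ ψ → ψ 1 ≢ + 0 → IsMultiplicative ψ → ψ 1 ≡ + 1
multiplicative-1 ψ ψ1≢0 ψ-mult = sym (ℤP.*-cancelʳ-≡ (+ 1) (ψ 1) (ψ 1) {{ℤ.≢-nonZero ψ1≢0}}
  (trans (ℤP.*-identityˡ (ψ 1)) (ψ-mult 1 1 ℕP.≤-refl ℕP.≤-refl)))

multiplicative-prodℕ : ∀ ψ → ψ 1 ≡ + 1 → IsMultiplicative ψ →
                       ∀ k {g} → (∀ j → 1 ≤ g j) → ψ (prodℕ k g) ≡ prodℤ k (ψ ∘ g)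
multiplicative-prodℕ ψ ψ1≡1 ψ-mult zero        g≥1 = ψ1≡1
multiplicative-prodℕ ψ ψ1≡1 ψ-mult (suc k) {g} g≥1 =
  trans (ψ-mult (prodℕ k g) (g k) (prodℕ-positive k g≥1) (g≥1 k))
        (cong (ℤ._* ψ (g k)) (multiplicative-prodℕ ψ ψ1≡1 ψ-mult k g≥1))

multiplicative-∣ : ∀ ψ → IsMultiplicative ψ → ∀ {a b} → 1 ≤ b → a ℕD.∣ b → ψ a ∣ ψ b
multiplicative-∣ ψ ψ-mult {a} {b} b≥1 (ℕD.divides q b≡q*a) =
  ℤD.∣⇒∣ᵤ {ψ a} {ψ b} (ℤD.divides (ψ q) (trans (cong ψ b≡q*a) (ψ-mult q a q≥1 a≥1)))
  where
  instance
    q*a≢0 : ℕ.NonZero (q * a)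
    q*a≢0 = ℕ.>-nonZero (subst (1 ≤_) b≡q*a b≥1)
  q≥1 : 1 ≤ q
  q≥1 = ℕ.>-nonZero⁻¹ q {{ℕP.m*n≢0⇒m≢0 q}}
  a≥1 : 1 ≤ a
  a≥1 = ℕ.>-nonZero⁻¹ a {{ℕP.m*n≢0⇒n≢0 q}}

multiplicative-BinomiallyDivisible : ∀ ψ {N} → ψ 1 ≡ + 1 → IsMultiplicative ψ → (∀ i → 1 ≤ N i) →
                                     BinomiallyDivisible (λ i → + N i) → BinomiallyDivisible (ψ ∘ N)
multiplicative-BinomiallyDivisible ψ {N} ψ1≡1 ψ-mult N≥1 div n k k≤n =
  subst₂ _∣_ (ψ-prod (λ j → j)) (ψ-prod (λ j → n ∸ suc j))
    (multiplicative-∣ ψ ψ-mult (prodℕ-positive k (λ j → N≥1 (n ∸ suc j)))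
      (subst₂ _∣_ (+-prod (λ j → j)) (+-prod (λ j → n ∸ suc j)) (div n k k≤n)))
  where
  +-prod : ∀ m → prodℤ k (λ j → + N (m j)) ≡ + prodℕ k (N ∘ m)
  +-prod m = sym (multiplicative-prodℕ (λ n → + n) refl +-isMultiplicative k (N≥1 ∘ m))
  ψ-prod : ∀ m → ψ (prodℕ k (N ∘ m)) ≡ prodℤ k (ψ ∘ N ∘ m)
  ψ-prod m = multiplicative-prodℕ ψ ψ1≡1 ψ-mult k (N≥1 ∘ m)

colNumeratorℕ : (ℕ → ℕ) → ℕ → ℕ → ℕ
colNumeratorℕ f c i = prodℕ c (λ j → f (i + c ∸ suc j))

colNumeratorℤ-multiplicative : ∀ ψ {f} → ψ 1 ≡ + 1 → IsMultiplicative ψ → (∀ i → 1 ≤ f i) →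
                               ∀ c i → colNumeratorℤ (ψ ∘ f) c i ≡ ψ (colNumeratorℕ f c i)
colNumeratorℤ-multiplicative ψ ψ1≡1 ψ-mult f≥1 c i = sym (multiplicative-prodℕ ψ ψ1≡1 ψ-mult c (λ j → f≥1 _))

multiplicative-BinomidAtLevel :
  (ψ : ℕ → ℤ) → (∀ n → 1 ≤ n → ψ n ≢ + 0) → IsMultiplicative ψ →
  (f : ℕ → ℕ) → (∀ i → 1 ≤ f i) → (c : ℕ) →
  BinomidAtLevel (λ i → + f i / 1) c → BinomidAtLevel (λ i → ψ (f i) / 1) c
multiplicative-BinomidAtLevel ψ ψ≢0 ψ-mult f f≥1 c binomid =
  Equivalence.from (BinomidAtLevel⇔BinomiallyDivisible c (λ i → ψ≢0 (f i) (f≥1 i)))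
    (BinomiallyDivisible-cong (sym ∘ colNumeratorℤ-multiplicative ψ ψ1≡1 ψ-mult f≥1 c)
      (multiplicative-BinomiallyDivisible ψ ψ1≡1 ψ-mult (λ i → prodℕ-positive c (λ j → f≥1 _))
        (BinomiallyDivisible-cong (colNumeratorℤ-multiplicative (λ n → + n) refl +-isMultiplicative f≥1 c)
          (Equivalence.to (BinomidAtLevel⇔BinomiallyDivisible c +f≢0) binomid))))
  where
  ψ1≡1 : ψ 1 ≡ + 1
  ψ1≡1 = multiplicative-1 ψ (ψ≢0 1 ℕP.≤-refl) ψ-mult
  +f≢0 : ∀ i → + f i ≢ + 0
  +f≢0 i = ℕP.n>0⇒n≢0 (f≥1 i) ∘ ℤP.+-injective

proposition1p5 :
    ((f : ℕ → ℤ) → (∀ i → f i ≢ + 0) → (∀ i → f i ∣ f (suc i)) →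
      BinomidAtEveryLevel (λ i → f i / 1))
    ×
    ((ψ : ℕ → ℤ) → (∀ n → 1 ≤ n → ψ n ≢ + 0) →
      (∀ m n → 1 ≤ m → 1 ≤ n → ψ (m * n) ≡ ψ m ℤ.* ψ n) →
      (f : ℕ → ℕ) → (∀ i → 1 ≤ f i) → (c : ℕ) →
      BinomidAtLevel (λ i → + f i / 1) c →
      BinomidAtLevel (λ i → ψ (f i) / 1) c)
proposition1p5 = ∣-chain⇒BinomidAtEveryLevel , multiplicative-BinomidAtLevel
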